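{- Let $n\geq1$ and $Z_n(x,t):=\sum_{d\geq0}P_{d,n}(x)t^d\in\mathbb{Q}[x][[t]]$. Then $Z_n(x,t)$ is a rational function in $t$ with coefficients in $\mathbb{Q}[x]$ if and only if $n=1$. However, for every root of unity $\zeta$, $Z_n(\zeta,t)$ is a rational function in $t$ with coefficients in $\mathbb{Q}(\zeta)$.
   Context: $P_{d,n}(x):=\dfrac{x^{\binom{d+n}{n}}-x^{\binom{d+n-1}{n}}}{x-1}\in\mathbb{Z}[x]$; for a prime power $q$, $P_{d,n}(q)$ is the number of monic (i.e. up to $\mathbb{F}_q^\times$-scaling) polynomials of total degree $d$ in $\mathbb{F}_q[x_1,\dots,x_n]$. -}

module Defs where

open import Level using (_⊔_)
open import Data.Bool using (Bool; true; false; if_then_else_; _∧_)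
open import Data.Nat as ℕ using (ℕ; zero; suc; _∸_; _≤ᵇ_; _<ᵇ_)
open import Data.Nat.Combinatorics using (_C_)
open import Data.Integer as ℤ using (ℤ; +_; -[1+_])
open import Data.Rational as ℚ using (ℚ; 0ℚ; 1ℚ)
open import Data.List using (List; []; _∷_)
open import Data.Product using (Σ; ∃; ∃-syntax; _×_)
open import Relation.Binary.PropositionalEquality using (_≡_)
open import Relation.Nullary using (¬_)
open import Algebra.Bundles using (CommutativeRing)

lo : ℕ → ℕ → ℕ
lo d n = (d ℕ.+ n ∸ 1) C n

hi : ℕ → ℕ → ℕ
hi d n = (d ℕ.+ n) C n

-- finitely supported coefficient function = element of ℚ[x]
IsPoly : (ℕ → ℚ) → Set
IsPoly f = ∃[ B ] (∀ j → B ℕ.≤ j → f j ≡ 0ℚ)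

sumℚ : ℕ → (ℕ → ℚ) → ℚ
sumℚ zero    g = 0ℚ
sumℚ (suc m) g = sumℚ m g ℚ.+ g m

_*ₚ_ : (ℕ → ℚ) → (ℕ → ℚ) → (ℕ → ℚ)
(f *ₚ g) j = sumℚ (suc j) (λ a → f a ℚ.* g (j ∸ a))

sumₚ : ℕ → (ℕ → ℕ → ℚ) → (ℕ → ℚ)
sumₚ m g j = sumℚ m (λ i → g i j)

-- P_{d,n}(x) = (x^hi - x^lo)/(x - 1) = sum_{lo ≤ j < hi} x^j,
-- given by its coefficient sequence
P : ℕ → ℕ → (ℕ → ℚ)
P d n j = if (lo d n ≤ᵇ j) ∧ (j <ᵇ hi d n) then 1ℚ else 0ℚ

-- Z_n(x,t) = sum_d P_{d,n}(x) t^d is rational in t over ℚ[x]: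
-- there is a nonzero B(t) = sum_{i ≤ k} c_i t^i ∈ ℚ[x][t] such that
-- B(t)·Z_n(x,t) is a polynomial in t, i.e. its t^e-coefficients vanish
-- for all large e (written e = d + k with d ≥ N).
RationalOverQx : ℕ → Set
RationalOverQx n =
  ∃[ k ] ∃ λ (c : ℕ → ℕ → ℚ) →
    ((∀ i → i ℕ.≤ k → IsPoly (c i))
    × (∃[ i ] (i ℕ.≤ k × ∃[ j ] (¬ c i j ≡ 0ℚ)))
    × ∃[ N ] (∀ d → N ℕ.≤ d → ∀ j →
        sumₚ (suc k) (λ i → c i *ₚ P (d ℕ.+ k ∸ i) n) j ≡ 0ℚ))

module OverRing {c ℓ} (K : CommutativeRing c ℓ) where
  open CommutativeRing K

  _^_ : Carrier → ℕ → Carrier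
  x ^ zero  = 1#
  x ^ suc m = x * (x ^ m)

  fromℕ : ℕ → Carrier
  fromℕ zero    = 0#
  fromℕ (suc m) = 1# + fromℕ m

  fromℤ : ℤ → Carrier
  fromℤ (+ m)     = fromℕ m
  fromℤ -[1+ m ]  = - fromℕ (suc m)

  IsField : Set (c ⊔ ℓ)
  IsField = (¬ 1# ≈ 0#) × (∀ x → ¬ x ≈ 0# → ∃[ y ] (x * y ≈ 1#))

  CharZero : Set ℓ
  CharZero = ∀ m → fromℕ m ≈ 0# → m ≡ 0

  IsRootOfUnity : Carrier → Set ℓ
  IsRootOfUnity ζ = ∃[ m ] (1 ℕ.≤ m × ζ ^ m ≈ 1#)

  -- evaluation of an integer polynomial (coefficient list, constant term first)
  evalℤ : List ℤ → Carrier → Carrier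
  evalℤ []       x = 0#
  evalℤ (a ∷ as) x = fromℤ a + x * evalℤ as x

  -- membership in the subfield ℚ(ζ) = { f(ζ)/g(ζ) : f, g ∈ ℤ[x], g(ζ) ≠ 0 }
  InQζ : Carrier → Carrier → Set ℓ
  InQζ ζ y = ∃[ f ] ∃[ g ] ((¬ evalℤ g ζ ≈ 0#) × (y * evalℤ g ζ ≈ evalℤ f ζ))

  sumK : ℕ → (ℕ → Carrier) → Carrier
  sumK zero    g = 0#
  sumK (suc m) g = sumK m g + g m

  Pat : Carrier → ℕ → ℕ → Carrier
  Pat ζ d n = sumK (hi d n) (λ j → if lo d n ≤ᵇ j then ζ ^ j else 0#)

  -- Z_n(ζ,t) = sum_d P_{d,n}(ζ) t^d is rational in t over ℚ(ζ):
  -- a nonzero B(t) = sum_{i ≤ k} c_i t^i with c_i ∈ ℚ(ζ) such that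
  -- B(t)·Z_n(ζ,t) is a polynomial in t.
  RationalOverQζ : Carrier → ℕ → Set (c ⊔ ℓ)
  RationalOverQζ ζ n =
    ∃[ k ] ∃ λ (b : ℕ → Carrier) →
      ((∀ i → i ℕ.≤ k → InQζ ζ (b i))
      × (∃[ i ] (i ℕ.≤ k × ¬ b i ≈ 0#))
      × ∃[ N ] (∀ d → N ℕ.≤ d →
          sumK (suc k) (λ i → b i * Pat ζ (d ℕ.+ k ∸ i) n) ≈ 0#))

module Submission where

open import Defs
open import Data.Nat using (ℕ; _≤_)
open import Data.Product using (_×_)
open import Function.Bundles using (_⇔_)
open import Relation.Binary.PropositionalEquality using (_≡_)
open import Algebra.Bundles using (CommutativeRing)

open import Data.Bool using (true; false; if_then_else_; _∧_)
open import Data.Bool.Properties using (∧-zeroʳ)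
import Data.Nat as ℕ
open import Data.Nat using (zero; suc; _∸_; _<_; z≤n; s≤s; _≤ᵇ_; _<ᵇ_; _≤′_; ≤′-refl; ≤′-step)
import Data.Nat.Properties as ℕP
open import Data.Nat.Combinatorics using (_C_; nC1≡n; nCk+nC[k+1]≡[n+1]C[k+1])
open import Data.Nat.Induction using (<-rec)
import Data.Integer as ℤ
open import Data.List using ([]; _∷_)
open import Data.Rational as ℚ using (ℚ; 0ℚ; 1ℚ)
import Data.Rational.Properties as ℚP
open import Data.Product using (∃-syntax; _,_; proj₁; proj₂)
open import Data.Sum using (_⊎_; inj₁; inj₂)
open import Data.Empty using (⊥-elim)
open import Function.Bundles using (mk⇔)
import Relation.Binary.PropositionalEquality as ≡
open import Relation.Binary.PropositionalEquality using (_≢_; cong; cong₂)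
open import Relation.Nullary using (¬_; yes; no)
open import Relation.Binary.Definitions using (tri<; tri≈; tri>)
open import Relation.Nullary.Reflects using (ofʸ; ofⁿ; det)

-- P_{d,n} = x^{lo d} + … + x^{hi d - 1}, and lo (d+1) = hi d.
-- For n = 1 this is xᵈ, so (1 - x t)·Z₁ = 1.  For n ≥ 2 the gaps
-- hi (d+1) - hi d = C(d+n, n-1) grow beyond every bound.  Given a candidate
-- denominator Σ_{i≤k} c_i tⁱ (lemma 'key'): if c_i = 0 for i < i₀ and c_{i₀}
-- has no terms above x^D, then for large d the coefficient of x^{D + hi e - 1}
-- (e = d + k - i₀) in the t^{d+k}-coefficient of the product is c_{i₀,D},
-- since every other P_{e'} (e' < e) lives below hi (e - 1).  So c_{i₀,D} = 0,
-- and induction (upwards in i₀, downwards in D) shows all c_i vanish.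
--
-- At ζ with ζᵐ = 1.  With S x = Σ_{j<x} ζʲ, P_{d,n}(ζ) = S (hi d) - S (lo d).
-- The map T x = m·S x - S m·x is m-periodic, and C(x, n) mod m has period
-- M = mⁿ in x; since the (n+1)-st difference with step M kills C(x + a, n) and
-- all M-periodic maps, it kills d ↦ S (C(d + a, n)) once m is cancelled
-- (characteristic 0).  The integer coefficients of (1 - t^M)^{n+1} therefore
-- form a denominator, as the convolution with them is that difference.

≤ᵇ-true : ∀ {a b} → a ≤ b → (a ≤ᵇ b) ≡ true
≤ᵇ-true {a} {b} a≤b = det (ℕP.≤ᵇ-reflects-≤ a b) (ofʸ a≤b)

≤ᵇ-false : ∀ {a b} → b < a → (a ≤ᵇ b) ≡ false
≤ᵇ-false {a} {b} b<a = det (ℕP.≤ᵇ-reflects-≤ a b) (ofⁿ (ℕP.<⇒≱ b<a))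

<ᵇ-true : ∀ {a b} → a < b → (a <ᵇ b) ≡ true
<ᵇ-true {a} {b} a<b = det (ℕP.<ᵇ-reflects-< a b) (ofʸ a<b)

<ᵇ-false : ∀ {a b} → b ≤ a → (a <ᵇ b) ≡ false
<ᵇ-false {a} {b} b≤a = det (ℕP.<ᵇ-reflects-< a b) (ofⁿ (ℕP.≤⇒≯ b≤a))

-- Binomial coefficients, and their periodicity modulo m.
module Binomial where
  open import Data.Nat using (_+_; _*_; _^_)
  open import Data.Nat.Tactic.RingSolver using (solve-∀)
  open ≡.≡-Reasoning

  +-swapʳ : ∀ a b c → (a + b) + c ≡ (a + c) + b
  +-swapʳ = solve-∀

  sumN : ℕ → (ℕ → ℕ) → ℕ
  sumN zero    g = 0
  sumN (suc m) g = sumN m g + g m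

  sumN-cong : ∀ m {f g} → (∀ i → f i ≡ g i) → sumN m f ≡ sumN m g
  sumN-cong zero    f≗g = ≡.refl
  sumN-cong (suc m) f≗g = cong₂ _+_ (sumN-cong m f≗g) (f≗g m)

  sumN-split : ∀ a b g → sumN (a + b) g ≡ sumN a g + sumN b (λ i → g (a + i))
  sumN-split a zero    g = ≡.trans (cong (λ z → sumN z g) (ℕP.+-identityʳ a)) (≡.sym (ℕP.+-identityʳ _))
  sumN-split a (suc b) g = begin
    sumN (a + suc b) g                                 ≡⟨ cong (λ z → sumN z g) (ℕP.+-suc a b) ⟩
    sumN (a + b) g + g (a + b)                         ≡⟨ cong (_+ g (a + b)) (sumN-split a b g) ⟩
    (sumN a g + sumN b (λ i → g (a + i))) + g (a + b)  ≡⟨ ℕP.+-assoc (sumN a g) _ _ ⟩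
    sumN a g + (sumN b (λ i → g (a + i)) + g (a + b))  ∎

  hockeyStick : ∀ x M n → (x + M) C suc n ≡ x C suc n + sumN M (λ s → (x + s) C n)
  hockeyStick x zero    n = ≡.trans (cong (_C suc n) (ℕP.+-identityʳ x)) (≡.sym (ℕP.+-identityʳ _))
  hockeyStick x (suc M) n = begin
    (x + suc M) C suc n                                        ≡⟨ cong (_C suc n) (ℕP.+-suc x M) ⟩
    suc (x + M) C suc n                                        ≡⟨ ≡.sym (nCk+nC[k+1]≡[n+1]C[k+1] (x + M) n) ⟩
    (x + M) C n + (x + M) C suc n                              ≡⟨ cong (λ z → (x + M) C n + z) (hockeyStick x M n) ⟩
    (x + M) C n + (x C suc n + sumN M (λ s → (x + s) C n))     ≡⟨ rearrange ((x + M) C n) (x C suc n) _ ⟩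
    x C suc n + (sumN M (λ s → (x + s) C n) + (x + M) C n)     ∎
    where
      rearrange : ∀ a b c → a + (b + c) ≡ b + (c + a)
      rearrange = solve-∀

  -- C(a + r, r) ≥ a + 1 for r ≥ 1 (already C(a + 1, 1) = a + 1).
  binomial-lower : ∀ a r → 1 ≤ r → suc a ≤ (a + r) C r
  binomial-lower a (suc zero)    _ = ℕP.≤-reflexive (≡.sym (≡.trans (nC1≡n (a + 1)) (ℕP.+-comm a 1)))
  binomial-lower a (suc (suc r)) _ =
    ℕP.≤-trans (binomial-lower a (suc r) (s≤s z≤n))
      (ℕP.≤-trans (ℕP.m≤m+n _ _)
        (ℕP.≤-reflexive (≡.trans (nCk+nC[k+1]≡[n+1]C[k+1] (a + suc r) (suc r))
                                 (cong (_C suc (suc r)) (≡.sym (ℕP.+-suc a (suc r)))))))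

  AddsMultiple : ℕ → ℕ → ℕ → Set
  AddsMultiple m x y = ∃[ t ] (y ≡ x + t * m)

  PeriodicMod : ℕ → ℕ → (ℕ → ℕ) → Set
  PeriodicMod m P g = ∀ x → AddsMultiple m (g x) (g (x + P))

  windowShift : ∀ m P g → PeriodicMod m P g → ∀ x Q →
                AddsMultiple m (sumN Q (λ s → g (x + s))) (sumN Q (λ s → g ((x + s) + P)))
  windowShift m P g per x zero    = 0 , ≡.refl
  windowShift m P g per x (suc Q) with windowShift m P g per x Q | per (x + Q)
  ... | t₁ , e₁ | t₂ , e₂ = t₁ + t₂ , (begin
    sumN Q (λ s → g ((x + s) + P)) + g ((x + Q) + P)             ≡⟨ cong₂ _+_ e₁ e₂ ⟩
    (W + t₁ * m) + (g (x + Q) + t₂ * m)                           ≡⟨ collect W (g (x + Q)) t₁ t₂ m ⟩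
    (W + g (x + Q)) + (t₁ + t₂) * m                               ∎)
    where
      W = sumN Q (λ s → g (x + s))
      collect : ∀ a b c d e → (a + c * e) + (b + d * e) ≡ (a + b) + (c + d) * e
      collect = solve-∀

  blockSum : ∀ m P g → PeriodicMod m P g → ∀ L x →
             AddsMultiple m (L * sumN P (λ s → g (x + s))) (sumN (L * P) (λ s → g (x + s)))
  blockSum m P g per zero    x = 0 , ≡.refl
  blockSum m P g per (suc L) x with blockSum m P g per L (x + P) | windowShift m P g per x P
  ... | t₁ , e₁ | t₂ , e₂ = L * t₂ + t₁ , (begin
    sumN (P + L * P) (λ s → g (x + s))                ≡⟨ sumN-split P (L * P) _ ⟩
    G + sumN (L * P) (λ s → g (x + (P + s)))          ≡⟨ cong (G +_) (sumN-cong (L * P) (λ s → cong g (≡.sym (ℕP.+-assoc x P s)))) ⟩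
    G + sumN (L * P) (λ s → g ((x + P) + s))          ≡⟨ cong (G +_) e₁ ⟩
    G + (L * sumN P (λ s → g ((x + P) + s)) + t₁ * m) ≡⟨ cong (λ z → G + (L * z + t₁ * m)) (sumN-cong P (λ s → cong g (+-swapʳ x P s))) ⟩
    G + (L * sumN P (λ s → g ((x + s) + P)) + t₁ * m) ≡⟨ cong (λ z → G + (L * z + t₁ * m)) e₂ ⟩
    G + (L * (G + t₂ * m) + t₁ * m)                   ≡⟨ collect G L t₁ t₂ m ⟩
    suc L * G + (L * t₂ + t₁) * m                     ∎)
    where
      G = sumN P (λ s → g (x + s))
      collect : ∀ G L a b m → G + (L * (G + b * m) + a * m) ≡ (G + L * G) + (L * b + a) * m
      collect = solve-∀

  -- x ↦ C(x, n) is periodic modulo m with period mⁿ: by the hockey stick identity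
  -- the step from C(x, n+1) to C(x + mⁿ⁺¹, n+1) is a sum of m windows of length mⁿ.
  binomial-periodic : ∀ m n → PeriodicMod m (m ^ n) (_C n)
  binomial-periodic m zero    x = 0 , ≡.refl
  binomial-periodic m (suc n) x with blockSum m (m ^ n) (_C n) (binomial-periodic m n) m x
  ... | t , e = G + t , (begin
    (x + m * m ^ n) C suc n                            ≡⟨ hockeyStick x (m * m ^ n) n ⟩
    x C suc n + sumN (m * m ^ n) (λ s → (x + s) C n)  ≡⟨ cong (λ z → x C suc n + z) e ⟩
    x C suc n + (m * G + t * m)                        ≡⟨ collect (x C suc n) G t m ⟩
    x C suc n + (G + t) * m                            ∎)
    where
      G = sumN (m ^ n) (λ s → (x + s) C n)
      collect : ∀ a G t m → a + (m * G + t * m) ≡ a + (G + t) * m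
      collect = solve-∀

open Binomial using (+-swapʳ; sumN; hockeyStick; binomial-lower; binomial-periodic)

module RingFacts {c ℓ} (R : CommutativeRing c ℓ) where
  open CommutativeRing R
  open OverRing R
  open import Algebra.Properties.CommutativeSemigroup +-commutativeSemigroup using (interchange; xy∙z≈xz∙y)
  open import Algebra.Properties.AbelianGroup +-abelianGroup using (⁻¹-∙-comm; ⁻¹-anti-homo‿-)
  open import Relation.Binary.Reasoning.Setoid setoid

  sub-+ : ∀ a b c d → (a + b) - (c + d) ≈ (a - c) + (b - d)
  sub-+ a b c d = trans (+-congˡ (sym (⁻¹-∙-comm c d))) (interchange a b (- c) (- d))

  sub-sub : ∀ a b c d → (a - b) - (c - d) ≈ (a - c) - (b - d)
  sub-sub a b c d = trans (sub-+ a (- b) c (- d)) (+-congˡ (⁻¹-∙-comm b (- d)))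

  -0≈0 : - 0# ≈ 0#
  -0≈0 = trans (sym (+-identityˡ _)) (-‿inverseʳ 0#)

  x-0≈x : ∀ x → x - 0# ≈ x
  x-0≈x x = trans (+-congˡ -0≈0) (+-identityʳ x)

  0-0≈0 : 0# - 0# ≈ 0#
  0-0≈0 = -‿inverseʳ 0#

  [a+b]-a≈b : ∀ a b → (a + b) - a ≈ b
  [a+b]-a≈b a b = trans (xy∙z≈xz∙y a b (- a)) (trans (+-congʳ (-‿inverseʳ a)) (+-identityˡ b))

  move-right : ∀ a b c → a + c ≈ b → a ≈ b - c
  move-right a b c a+c≈b = trans (sym ([a+b]-a≈b c a)) (+-congʳ (trans (+-comm c a) a+c≈b))

  cancel-nonzero : (∀ x → ¬ x ≈ 0# → ∃[ y ] (x * y ≈ 1#)) → ∀ {a b} → ¬ a ≈ 0# → a * b ≈ 0# → b ≈ 0#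
  cancel-nonzero inverse {a} {b} a≉0 ab≈0 with inverse a a≉0
  ... | a⁻¹ , aa⁻¹≈1 = begin
    b               ≈⟨ sym (*-identityˡ b) ⟩
    1# * b          ≈⟨ *-congʳ (trans (sym aa⁻¹≈1) (*-comm a a⁻¹)) ⟩
    (a⁻¹ * a) * b   ≈⟨ *-assoc a⁻¹ a b ⟩
    a⁻¹ * (a * b)   ≈⟨ *-congˡ ab≈0 ⟩
    a⁻¹ * 0#        ≈⟨ zeroʳ a⁻¹ ⟩
    0#              ∎

  sum-cong : ∀ m {f g} → (∀ i → i < m → f i ≈ g i) → sumK m f ≈ sumK m g
  sum-cong zero    f≈g = refl
  sum-cong (suc m) f≈g = +-cong (sum-cong m (λ i i<m → f≈g i (ℕP.m<n⇒m<1+n i<m))) (f≈g m ℕP.≤-refl)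

  sum-zero : ∀ m {f} → (∀ i → i < m → f i ≈ 0#) → sumK m f ≈ 0#
  sum-zero m f≈0 = trans (sum-cong m f≈0) (zeros m)
    where zeros : ∀ m → sumK m (λ _ → 0#) ≈ 0#
          zeros zero    = refl
          zeros (suc m) = trans (+-identityʳ _) (zeros m)

  sum-single : ∀ m i₀ {f} → i₀ < m → (∀ i → i < m → i ≢ i₀ → f i ≈ 0#) → sumK m f ≈ f i₀
  sum-single (suc m) i₀ {f} i₀<1+m others with ℕP.m<1+n⇒m<n∨m≡n i₀<1+m
  ... | inj₂ ≡.refl = trans (+-congʳ (sum-zero m (λ i i<m → others i (ℕP.m<n⇒m<1+n i<m) (λ { ≡.refl → ℕP.<-irrefl ≡.refl i<m }))))
                            (+-identityˡ (f m))
  ... | inj₁ i₀<m   = trans (+-cong (sum-single m i₀ i₀<m (λ i i<m → others i (ℕP.m<n⇒m<1+n i<m)))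
                                    (others m ℕP.≤-refl (λ { ≡.refl → ℕP.<-irrefl ≡.refl i₀<m })))
                            (+-identityʳ (f i₀))

  sum-+ : ∀ m f g → sumK m (λ i → f i + g i) ≈ sumK m f + sumK m g
  sum-+ zero    f g = sym (+-identityʳ 0#)
  sum-+ (suc m) f g = trans (+-congʳ (sum-+ m f g)) (interchange _ _ _ _)

  sum-- : ∀ m f g → sumK m (λ i → f i - g i) ≈ sumK m f - sumK m g
  sum-- m f g = trans (sum-+ m f (λ i → - g i)) (+-congˡ (negate m))
    where negate : ∀ m → sumK m (λ i → - g i) ≈ - sumK m g
          negate zero    = sym -0≈0
          negate (suc m) = trans (+-congʳ (negate m)) (⁻¹-∙-comm _ _)

  sum-split : ∀ a b f → sumK (a ℕ.+ b) f ≈ sumK a f + sumK b (λ i → f (a ℕ.+ i))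
  sum-split a zero    f = trans (reflexive (cong (λ z → sumK z f) (ℕP.+-identityʳ a))) (sym (+-identityʳ _))
  sum-split a (suc b) f = begin
    sumK (a ℕ.+ suc b) f                                   ≡⟨ cong (λ z → sumK z f) (ℕP.+-suc a b) ⟩
    sumK (a ℕ.+ b) f + f (a ℕ.+ b)                         ≈⟨ +-congʳ (sum-split a b f) ⟩
    (sumK a f + sumK b (λ i → f (a ℕ.+ i))) + f (a ℕ.+ b)  ≈⟨ +-assoc _ _ _ ⟩
    sumK a f + (sumK b (λ i → f (a ℕ.+ i)) + f (a ℕ.+ b))  ∎

  sum-from : ∀ h l (g : ℕ → Carrier) → l ≤ h →
             sumK h (λ j → if l ≤ᵇ j then g j else 0#) + sumK l g ≈ sumK h g
  sum-from h l g l≤h with ℕP.m≤n⇒m<n∨m≡n l≤h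
  sum-from (suc h) l g _ | inj₁ l<1+h = begin
    (sumK h F + F h) + sumK l g  ≈⟨ xy∙z≈xz∙y _ _ _ ⟩
    (sumK h F + sumK l g) + F h  ≈⟨ +-cong (sum-from h l g (ℕP.≤-pred l<1+h)) (reflexive (cong (if_then g h else 0#) (≤ᵇ-true (ℕP.≤-pred l<1+h)))) ⟩
    sumK h g + g h               ∎
    where F : ℕ → Carrier
          F j = if l ≤ᵇ j then g j else 0#
  sum-from h .h g _ | inj₂ ≡.refl =
    trans (+-congʳ (sum-zero h (λ j j<h → reflexive (cong (if_then g j else 0#) (≤ᵇ-false j<h))))) (+-identityˡ _)

  fromℕ-+ : ∀ a b → fromℕ (a ℕ.+ b) ≈ fromℕ a + fromℕ b
  fromℕ-+ zero    b = sym (+-identityˡ _)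
  fromℕ-+ (suc a) b = trans (+-congˡ (fromℕ-+ a b)) (sym (+-assoc _ _ _))

  fromℕ-sum : ∀ m g → fromℕ (sumN m g) ≈ sumK m (λ s → fromℕ (g s))
  fromℕ-sum zero    g = refl
  fromℕ-sum (suc m) g = trans (fromℕ-+ (sumN m g) (g m)) (+-congʳ (fromℕ-sum m g))

  IsInteger : Carrier → Set ℓ
  IsInteger y = ∃[ p ] ∃[ q ] (y ≈ fromℕ p - fromℕ q)

  integer-0 : IsInteger 0#
  integer-0 = 0 , 0 , sym 0-0≈0

  integer-1 : IsInteger 1#
  integer-1 = 1 , 0 , sym (trans (x-0≈x _) (+-identityʳ 1#))

  integer-- : ∀ {a b} → IsInteger a → IsInteger b → IsInteger (a - b)
  integer-- {a} {b} (p , q , a≈) (p′ , q′ , b≈) = p ℕ.+ q′ , q ℕ.+ p′ , (begin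
    a - b                          ≈⟨ +-cong a≈ (-‿cong b≈) ⟩
    (fromℕ p - fromℕ q) - (fromℕ p′ - fromℕ q′)  ≈⟨ +-congˡ (⁻¹-anti-homo‿- (fromℕ p′) (fromℕ q′)) ⟩
    (fromℕ p - fromℕ q) + (fromℕ q′ - fromℕ p′)  ≈⟨ sym (sub-+ _ _ _ _) ⟩
    (fromℕ p + fromℕ q′) - (fromℕ q + fromℕ p′)  ≈⟨ sym (+-cong (fromℕ-+ p q′) (-‿cong (fromℕ-+ q p′))) ⟩
    fromℕ (p ℕ.+ q′) - fromℕ (q ℕ.+ p′)          ∎)

  difference-fromℤ : ∀ p q → ∃[ z ] (fromℤ z ≈ fromℕ p - fromℕ q)
  difference-fromℤ p       zero    = ℤ.+ p , sym (x-0≈x _)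
  difference-fromℤ zero    (suc q) = ℤ.-[1+ q ] , sym (+-identityˡ _)
  difference-fromℤ (suc p) (suc q) with difference-fromℤ p q
  ... | z , z≈ = z , (begin
    fromℤ z                              ≈⟨ z≈ ⟩
    fromℕ p - fromℕ q                    ≈⟨ sym (+-identityˡ _) ⟩
    0# + (fromℕ p - fromℕ q)             ≈⟨ +-congʳ (sym (-‿inverseʳ 1#)) ⟩
    (1# - 1#) + (fromℕ p - fromℕ q)      ≈⟨ sym (sub-+ _ _ _ _) ⟩
    (1# + fromℕ p) - (1# + fromℕ q)      ∎)

  integer⇒InQζ : ¬ 1# ≈ 0# → ∀ ζ {y} → IsInteger y → InQζ ζ y
  integer⇒InQζ 1≉0 ζ {y} (p , q , y≈) with difference-fromℤ p q
  ... | z , z≈ = z ∷ [] , ℤ.+ 1 ∷ [] , (λ 1≈0 → 1≉0 (trans (sym eval-1) 1≈0)) ,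
      trans (*-congˡ eval-1) (trans (*-identityʳ y) (trans y≈ (trans (sym z≈) (sym (eval-const z)))))
    where
      eval-const : ∀ a → evalℤ (a ∷ []) ζ ≈ fromℤ a
      eval-const a = trans (+-congˡ (zeroʳ ζ)) (+-identityʳ _)
      eval-1 : evalℤ (ℤ.+ 1 ∷ []) ζ ≈ 1#
      eval-1 = trans (eval-const (ℤ.+ 1)) (+-identityʳ 1#)

-- Rationality over ℚ[x]: true for n = 1, false for n ≥ 2.
module OverQx where
  open import Data.Nat using (_+_)
  open ≡.≡-Reasoning

  ℚ-ring : CommutativeRing _ _
  ℚ-ring = ℚP.+-*-commutativeRing

  open RingFacts ℚ-ring using (sum-zero; sum-single)

  sumℚ≡sumK : ∀ m g → sumℚ m g ≡ OverRing.sumK ℚ-ring m g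
  sumℚ≡sumK zero    g = ≡.refl
  sumℚ≡sumK (suc m) g = cong (ℚ._+ g m) (sumℚ≡sumK m g)

  product-zero : ∀ {a b} → a ≡ 0ℚ ⊎ b ≡ 0ℚ → a ℚ.* b ≡ 0ℚ
  product-zero {b = b} (inj₁ ≡.refl) = ℚP.*-zeroˡ b
  product-zero {a = a} (inj₂ ≡.refl) = ℚP.*-zeroʳ a

  conv-zero : ∀ c g j → (∀ a → a ≤ j → c a ≡ 0ℚ ⊎ g (j ∸ a) ≡ 0ℚ) → (c *ₚ g) j ≡ 0ℚ
  conv-zero c g j factor = ≡.trans (sumℚ≡sumK (suc j) _)
    (sum-zero (suc j) (λ a a≤j → product-zero (factor a (ℕP.≤-pred a≤j))))

  conv-single : ∀ c g j a₀ → a₀ ≤ j → (∀ a → a ≤ j → a ≢ a₀ → c a ≡ 0ℚ ⊎ g (j ∸ a) ≡ 0ℚ) →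
                (c *ₚ g) j ≡ c a₀ ℚ.* g (j ∸ a₀)
  conv-single c g j a₀ a₀≤j factor = ≡.trans (sumℚ≡sumK (suc j) _)
    (sum-single (suc j) a₀ (s≤s a₀≤j) (λ a a≤j a≢a₀ → product-zero (factor a (ℕP.≤-pred a≤j) a≢a₀)))

  -- The coefficient sequence of x^l + … + x^{h-1};  P d n = window (lo d n) (hi d n).
  window : ℕ → ℕ → ℕ → ℚ
  window l h j = if (l ≤ᵇ j) ∧ (j <ᵇ h) then 1ℚ else 0ℚ

  window-above : ∀ {l h j} → h ≤ j → window l h j ≡ 0ℚ
  window-above {l} {h} {j} h≤j rewrite <ᵇ-false h≤j | ∧-zeroʳ (l ≤ᵇ j) = ≡.refl

  window-inside : ∀ {l h j} → l ≤ j → j < h → window l h j ≡ 1ℚ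
  window-inside l≤j j<h rewrite ≤ᵇ-true l≤j | <ᵇ-true j<h = ≡.refl

  window-shift : ∀ l h j → window (suc l) (suc h) (suc j) ≡ window l h j
  window-shift zero    h j = ≡.refl
  window-shift (suc l) h j = ≡.refl

  P-deg1 : ∀ d j → P d 1 j ≡ window d (suc d) j
  P-deg1 d j = cong₂ (λ l h → window l h j)
                     (≡.trans (nC1≡n (d + 1 ∸ 1)) (ℕP.m+n∸n≡m d 1))
                     (≡.trans (nC1≡n (d + 1)) (ℕP.+-comm d 1))

  -- The coefficients (first in t, then in x) of the denominator 1 - x t of Z₁.
  oneMinusXt : ℕ → ℕ → ℚ
  oneMinusXt 0 0 = 1ℚ
  oneMinusXt 1 1 = ℚ.- 1ℚ
  oneMinusXt _ _ = 0ℚ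

  -- The t^{d+1}-coefficient of (1 - x t)·Z₁ is x^{d+1} - x·xᵈ = 0.
  oneMinusXt-kills : ∀ d j → sumₚ 2 (λ i → oneMinusXt i *ₚ P (d + 1 ∸ i) 1) j ≡ 0ℚ
  oneMinusXt-kills d j = begin
    (0ℚ ℚ.+ (oneMinusXt 0 *ₚ P (d + 1) 1) j) ℚ.+ (oneMinusXt 1 *ₚ P (d + 1 ∸ 1) 1) j
      ≡⟨ cong₂ (λ u v → (0ℚ ℚ.+ u) ℚ.+ v) constantTerm (linearTerm j) ⟩
    (0ℚ ℚ.+ P (suc d) 1 j) ℚ.+ ℚ.- shifted j
      ≡⟨ cong (λ u → (0ℚ ℚ.+ u) ℚ.+ ℚ.- shifted j) (shift j) ⟩
    (0ℚ ℚ.+ shifted j) ℚ.+ ℚ.- shifted j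
      ≡⟨ ≡.trans (cong (ℚ._+ ℚ.- shifted j) (ℚP.+-identityˡ (shifted j))) (ℚP.+-inverseʳ (shifted j)) ⟩
    0ℚ ∎
    where
      shifted : ℕ → ℚ
      shifted zero    = 0ℚ
      shifted (suc j) = P d 1 j

      shift : ∀ j → P (suc d) 1 j ≡ shifted j
      shift zero    = P-deg1 (suc d) 0
      shift (suc j) = ≡.trans (P-deg1 (suc d) (suc j)) (≡.trans (window-shift d (suc d) j) (≡.sym (P-deg1 d j)))

      constantTerm : (oneMinusXt 0 *ₚ P (d + 1) 1) j ≡ P (suc d) 1 j
      constantTerm = ≡.trans (conv-single (oneMinusXt 0) (P (d + 1) 1) j 0 z≤n
                               (λ { zero _ 0≢0 → ⊥-elim (0≢0 ≡.refl) ; (suc a) _ _ → inj₁ ≡.refl }))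
                     (≡.trans (ℚP.*-identityˡ _) (cong (λ e → P e 1 j) (ℕP.+-comm d 1)))

      linearTerm : ∀ j → (oneMinusXt 1 *ₚ P (d + 1 ∸ 1) 1) j ≡ ℚ.- shifted j
      linearTerm zero    = conv-zero (oneMinusXt 1) (P (d + 1 ∸ 1) 1) 0 (λ { zero _ → inj₁ ≡.refl })
      linearTerm (suc j) = begin
        (oneMinusXt 1 *ₚ P (d + 1 ∸ 1) 1) (suc j)
          ≡⟨ conv-single (oneMinusXt 1) (P (d + 1 ∸ 1) 1) (suc j) 1 (s≤s z≤n)
               (λ { zero _ _ → inj₁ ≡.refl ; (suc zero) _ 1≢1 → ⊥-elim (1≢1 ≡.refl) ; (suc (suc a)) _ _ → inj₁ ≡.refl }) ⟩
        ℚ.- 1ℚ ℚ.* P (d + 1 ∸ 1) 1 j  ≡⟨ cong (λ e → ℚ.- 1ℚ ℚ.* P e 1 j) (ℕP.m+n∸n≡m d 1) ⟩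
        ℚ.- 1ℚ ℚ.* P d 1 j            ≡⟨ ≡.sym (ℚP.neg-distribˡ-* 1ℚ (P d 1 j)) ⟩
        ℚ.- (1ℚ ℚ.* P d 1 j)          ≡⟨ cong ℚ.-_ (ℚP.*-identityˡ (P d 1 j)) ⟩
        ℚ.- P d 1 j                   ∎

  rational-deg1 : RationalOverQx 1
  rational-deg1 = 1 , oneMinusXt , (λ i _ → 2 , polynomial i) , (0 , z≤n , 0 , λ ()) ,
                  0 , λ d _ → oneMinusXt-kills d
    where
      polynomial : ∀ i j → 2 ≤ j → oneMinusXt i j ≡ 0ℚ
      polynomial 0             (suc (suc j)) _ = ≡.refl
      polynomial 1             (suc (suc j)) _ = ≡.refl
      polynomial (suc (suc i)) j             _ = ≡.refl
      polynomial 0             (suc zero)    (s≤s ())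
      polynomial 1             (suc zero)    (s≤s ())

  hi-step : ∀ e r → hi (suc e) (suc r) ≡ (e + suc r) C r + hi e (suc r)
  hi-step e r = ≡.sym (nCk+nC[k+1]≡[n+1]C[k+1] (e + suc r) r)

  hi-mono : ∀ r {e e′} → e ≤′ e′ → hi e (suc r) ≤ hi e′ (suc r)
  hi-mono r ≤′-refl            = ℕP.≤-refl
  hi-mono r (≤′-step {e′} e≤e′) =
    ℕP.≤-trans (hi-mono r e≤e′) (ℕP.≤-trans (ℕP.m≤n+m _ _) (ℕP.≤-reflexive (≡.sym (hi-step e′ r))))

  gap-lower : ∀ r e → suc (suc e) ≤ (e + suc (suc r)) C suc r
  gap-lower r e = ≡.subst (λ x → suc (suc e) ≤ x C suc r) (≡.sym (ℕP.+-suc e (suc r)))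
                          (binomial-lower (suc e) (suc r) (s≤s z≤n))

  gap : ∀ r e → ∃[ g ] (e < g × hi (suc e) (2 + r) ≡ suc (g + hi e (2 + r)))
  gap r e with (e + suc (suc r)) C suc r | hi-step e (suc r) | gap-lower r e
  ... | suc g | step | s≤s e<g = g , e<g , step

  common-bound : ∀ (c : ℕ → ℕ → ℚ) k → (∀ i → i ≤ k → IsPoly (c i)) →
                 ∃[ B ] (∀ i → i ≤ k → ∀ j → B ≤ j → c i j ≡ 0ℚ)
  common-bound c zero    polys with polys 0 z≤n
  ... | B , bound = B , λ { .0 z≤n j B≤j → bound j B≤j }
  common-bound c (suc k) polys
    with common-bound c k (λ i i≤k → polys i (ℕP.m≤n⇒m≤1+n i≤k)) | polys (suc k) ℕP.≤-refl
  ... | B₁ , bound₁ | B₂ , bound₂ = B₁ ℕ.⊔ B₂ , bound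
    where
      bound : ∀ i → i ≤ suc k → ∀ j → B₁ ℕ.⊔ B₂ ≤ j → c i j ≡ 0ℚ
      bound i i≤1+k j B≤j with ℕP.m≤n⇒m<n∨m≡n i≤1+k
      ... | inj₁ i<1+k  = bound₁ i (ℕP.≤-pred i<1+k) j (ℕP.≤-trans (ℕP.m≤m⊔n B₁ B₂) B≤j)
      ... | inj₂ ≡.refl = bound₂ j (ℕP.≤-trans (ℕP.m≤n⊔m B₁ B₂) B≤j)

  module NoDenominator (r k : ℕ) (c : ℕ → ℕ → ℚ) (polys : ∀ i → i ≤ k → IsPoly (c i)) (N : ℕ)
      (kills : ∀ d → N ≤ d → ∀ j → sumₚ (suc k) (λ i → c i *ₚ P (d + k ∸ i) (2 + r)) j ≡ 0ℚ) where

    n : ℕ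
    n = 2 + r

    B : ℕ
    B = proj₁ (common-bound c k polys)

    bound : ∀ i → i ≤ k → ∀ j → B ≤ j → c i j ≡ 0ℚ
    bound = proj₂ (common-bound c k polys)

    -- If c_i = 0 for i < i₀ and c_{i₀} has no terms above x^D, then c_{i₀,D} = 0:
    -- it is the only contribution to the coefficient of x^{D + hi e - 1}.
    key : ∀ i₀ D → i₀ ≤ k → (∀ i → i < i₀ → ∀ a → c i a ≡ 0ℚ) → (∀ a → D < a → c i₀ a ≡ 0ℚ) →
          c i₀ D ≡ 0ℚ
    key i₀ D i₀≤k below above with gap r (N + B + (k ∸ i₀))
    ... | g , e′<g , hi-jump = begin
      c i₀ D                                         ≡⟨ ≡.sym (ℚP.*-identityʳ (c i₀ D)) ⟩
      c i₀ D ℚ.* 1ℚ                                  ≡⟨ cong (c i₀ D ℚ.*_) (≡.sym top) ⟩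
      c i₀ D ℚ.* P e n (j ∸ D)                       ≡⟨ ≡.sym leading ⟩
      (c i₀ *ₚ P e n) j                              ≡⟨ cong (λ z → (c i₀ *ₚ P z n) j) (≡.sym e-def) ⟩
      (c i₀ *ₚ P (d + k ∸ i₀) n) j                   ≡⟨ ≡.sym only-i₀ ⟩
      sumₚ (suc k) (λ i → c i *ₚ P (d + k ∸ i) n) j  ≡⟨ kills d (ℕP.≤-trans (ℕP.m≤m+n N B) (ℕP.n≤1+n _)) j ⟩
      0ℚ                                             ∎
      where
        e′ e d H j : ℕ
        e′ = N + B + (k ∸ i₀)
        e  = suc e′
        d  = suc (N + B)
        H  = g + hi e′ n
        j  = D + H

        e-def : d + k ∸ i₀ ≡ e
        e-def = ℕP.+-∸-assoc d i₀≤k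

        B≤g : B ≤ g
        B≤g = ℕP.≤-trans (ℕP.≤-trans (ℕP.m≤n+m B N) (ℕP.m≤m+n (N + B) (k ∸ i₀))) (ℕP.<⇒≤ e′<g)

        -- x^H is the top term of P e = x^{hi e′} + … + x^H
        top : P e n (j ∸ D) ≡ 1ℚ
        top = ≡.trans (cong (P e n) (ℕP.m+n∸m≡n D H))
                      (window-inside {lo e n} {hi e n} (ℕP.m≤n+m (hi e′ n) g) (ℕP.≤-reflexive (≡.sym hi-jump)))

        leading : (c i₀ *ₚ P e n) j ≡ c i₀ D ℚ.* P e n (j ∸ D)
        leading = conv-single (c i₀) (P e n) j D (ℕP.m≤m+n D H) others
          where
            others : ∀ a → a ≤ j → a ≢ D → c i₀ a ≡ 0ℚ ⊎ P e n (j ∸ a) ≡ 0ℚ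
            others a _ a≢D with ℕP.<-cmp a D
            ... | tri< a<D _ _ = inj₂ (window-above {lo e n} {hi e n}
                                  (≡.subst (_≤ j ∸ a) (≡.sym hi-jump) (ℕP.m+n≤o⇒m≤o∸n (suc H) le)))
              where le : suc H + a ≤ j
                    le = ℕP.≤-trans (ℕP.≤-reflexive (≡.sym (ℕP.+-suc H a)))
                           (ℕP.≤-trans (ℕP.+-monoʳ-≤ H a<D) (ℕP.≤-reflexive (ℕP.+-comm H D)))
            ... | tri≈ _ a≡D _ = ⊥-elim (a≢D a≡D)
            ... | tri> _ _ D<a = inj₁ (above a D<a)

        -- for i > i₀ the polynomial P (d+k-i) lives below hi e′, and c_i below x^B
        later : ∀ i → i ≤ k → i₀ < i → (c i *ₚ P (d + k ∸ i) n) j ≡ 0ℚ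
        later i i≤k i₀<i = conv-zero (c i) (P (d + k ∸ i) n) j factor
          where
            eᵢ≤e′ : d + k ∸ i ≤ e′
            eᵢ≤e′ = ℕP.≤-pred (≡.subst (d + k ∸ i <_) e-def
                      (ℕP.∸-monoʳ-< i₀<i (ℕP.≤-trans i≤k (ℕP.m≤n+m k d))))
            factor : ∀ a → a ≤ j → c i a ≡ 0ℚ ⊎ P (d + k ∸ i) n (j ∸ a) ≡ 0ℚ
            factor a _ with B ℕ.≤? a
            ... | yes B≤a = inj₁ (bound i i≤k a B≤a)
            ... | no  B≰a = inj₂ (window-above {lo (d + k ∸ i) n} {hi (d + k ∸ i) n}
                              (ℕP.m+n≤o⇒m≤o∸n (hi (d + k ∸ i) n) le))
              where le : hi (d + k ∸ i) n + a ≤ j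
                    le = ℕP.≤-trans (ℕP.+-mono-≤ (hi-mono (suc r) (ℕP.≤⇒≤′ eᵢ≤e′))
                                                 (ℕP.≤-trans (ℕP.<⇒≤ (ℕP.≰⇒> B≰a)) B≤g))
                           (ℕP.≤-trans (ℕP.≤-reflexive (ℕP.+-comm (hi e′ n) g)) (ℕP.m≤n+m H D))

        only-i₀ : sumₚ (suc k) (λ i → c i *ₚ P (d + k ∸ i) n) j ≡ (c i₀ *ₚ P (d + k ∸ i₀) n) j
        only-i₀ = ≡.trans (sumℚ≡sumK (suc k) _) (sum-single (suc k) i₀ (s≤s i₀≤k) others)
          where
            others : ∀ i → i < suc k → i ≢ i₀ → (c i *ₚ P (d + k ∸ i) n) j ≡ 0ℚ
            others i i<1+k i≢i₀ with ℕP.<-cmp i i₀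
            ... | tri< i<i₀ _ _ = conv-zero (c i) (P (d + k ∸ i) n) j (λ a _ → inj₁ (below i i<i₀ a))
            ... | tri≈ _ i≡i₀ _ = ⊥-elim (i≢i₀ i≡i₀)
            ... | tri> _ _ i₀<i = later i (ℕP.≤-pred i<1+k) i₀<i

    column : ∀ i₀ → i₀ ≤ k → (∀ i → i < i₀ → ∀ a → c i a ≡ 0ℚ) → ∀ s a → B ≤ s + a → c i₀ a ≡ 0ℚ
    column i₀ i₀≤k below zero    a B≤a     = bound i₀ i₀≤k a B≤a
    column i₀ i₀≤k below (suc s) a B≤1+s+a = key i₀ a i₀≤k below
      (λ a′ a<a′ → column i₀ i₀≤k below s a′ (ℕP.≤-trans B≤1+s+a (ℕP.+-monoʳ-< s a<a′)))

    vanish : ∀ i → i ≤ k → ∀ a → c i a ≡ 0ℚ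
    vanish = <-rec (λ i → i ≤ k → ∀ a → c i a ≡ 0ℚ) step
      where
        step : ∀ i → (∀ {i′} → i′ < i → i′ ≤ k → ∀ a → c i′ a ≡ 0ℚ) → i ≤ k → ∀ a → c i a ≡ 0ℚ
        step i lower i≤k a =
          column i i≤k (λ i′ i′<i → lower i′<i (ℕP.≤-trans (ℕP.<⇒≤ i′<i) i≤k)) B a (ℕP.m≤m+n B a)

  not-rational : ∀ r → ¬ RationalOverQx (2 + r)
  not-rational r (k , c , polys , (i , i≤k , j , cᵢⱼ≢0) , N , kills) =
    cᵢⱼ≢0 (NoDenominator.vanish r k c polys N kills i i≤k j)

-- Rationality at a root of unity ζ of a commutative ring K.
module AtRootOfUnity {c ℓ} (K : CommutativeRing c ℓ) where
  open CommutativeRing K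
  open OverRing K
  open RingFacts K
  open import Algebra.Properties.Ring ring using (x[y-z]≈xy-xz; [y-z]x≈yx-zx)
  open import Algebra.Properties.CommutativeSemigroup +-commutativeSemigroup using (xy∙z≈xz∙y)
  open import Relation.Binary.Reasoning.Setoid setoid

  module Difference (M : ℕ) where
    Δ : (ℕ → Carrier) → ℕ → Carrier
    Δ u d = u (d ℕ.+ M) - u d

    Δ^ : ℕ → (ℕ → Carrier) → ℕ → Carrier
    Δ^ zero    u = u
    Δ^ (suc j) u = Δ^ j (Δ u)

    Δ^-cong : ∀ j {u v} → (∀ d → u d ≈ v d) → ∀ d → Δ^ j u d ≈ Δ^ j v d
    Δ^-cong zero    u≈v = u≈v
    Δ^-cong (suc j) u≈v = Δ^-cong j (λ e → +-cong (u≈v (e ℕ.+ M)) (-‿cong (u≈v e)))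

    Δ^-+ : ∀ j u v d → Δ^ j (λ e → u e + v e) d ≈ Δ^ j u d + Δ^ j v d
    Δ^-+ zero    u v d = refl
    Δ^-+ (suc j) u v d = trans (Δ^-cong j (λ e → sub-+ _ _ _ _) d) (Δ^-+ j (Δ u) (Δ v) d)

    Δ^-- : ∀ j u v d → Δ^ j (λ e → u e - v e) d ≈ Δ^ j u d - Δ^ j v d
    Δ^-- zero    u v d = refl
    Δ^-- (suc j) u v d = trans (Δ^-cong j (λ e → sub-sub _ _ _ _) d) (Δ^-- j (Δ u) (Δ v) d)

    Δ^-*ˡ : ∀ j x u d → Δ^ j (λ e → x * u e) d ≈ x * Δ^ j u d
    Δ^-*ˡ zero    x u d = refl
    Δ^-*ˡ (suc j) x u d = trans (Δ^-cong j (λ e → sym (x[y-z]≈xy-xz x _ _)) d) (Δ^-*ˡ j x (Δ u) d)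

    Δ^-zero : ∀ j u → (∀ e → u e ≈ 0#) → ∀ d → Δ^ j u d ≈ 0#
    Δ^-zero zero    u u≈0 = u≈0
    Δ^-zero (suc j) u u≈0 = Δ^-zero j (Δ u) (λ e → trans (+-cong (u≈0 _) (-‿cong (u≈0 e))) 0-0≈0)

    Δ^-periodic : ∀ j u → (∀ e → u (e ℕ.+ M) ≈ u e) → ∀ d → Δ^ (suc j) u d ≈ 0#
    Δ^-periodic j u periodic = Δ^-zero j (Δ u) (λ e → trans (+-congʳ (periodic e)) (-‿inverseʳ (u e)))

    Δ^-shift : ∀ j u d → Δ^ j (λ e → u (e ℕ.+ M)) d ≡ Δ^ j u (d ℕ.+ M)
    Δ^-shift zero    u d = ≡.refl
    Δ^-shift (suc j) u d = Δ^-shift j (Δ u) d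

    Δ^-suc : ∀ j u d → Δ^ (suc j) u d ≈ Δ^ j u (d ℕ.+ M) - Δ^ j u d
    Δ^-suc j u d = trans (Δ^-- j (λ e → u (e ℕ.+ M)) u d) (+-congʳ (reflexive (Δ^-shift j u d)))

    Δ^-sum : ∀ j m (w : ℕ → ℕ → Carrier) d →
             Δ^ j (λ e → sumK m (λ s → w s e)) d ≈ sumK m (λ s → Δ^ j (w s) d)
    Δ^-sum j zero    w d = Δ^-zero j (λ _ → 0#) (λ _ → refl) d
    Δ^-sum j (suc m) w d = trans (Δ^-+ j (λ e → sumK m (λ s → w s e)) (w m) d) (+-congʳ (Δ^-sum j m w d))

    -- Δ^{n+1} kills the degree-n polynomial e ↦ C(e + a, n): by the hockey stick
    -- identity, Δ turns C(· + a, n+1) into a sum of shifted copies of C(·, n).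
    Δ^-binomial : ∀ n a d → Δ^ (suc n) (λ e → fromℕ ((e ℕ.+ a) C n)) d ≈ 0#
    Δ^-binomial zero    a d = -‿inverseʳ _
    Δ^-binomial (suc n) a d = begin
      Δ^ (suc n) (Δ (λ e → fromℕ ((e ℕ.+ a) C suc n))) d                 ≈⟨ Δ^-cong (suc n) hockey d ⟩
      Δ^ (suc n) (λ e → sumK M (λ s → fromℕ ((e ℕ.+ (a ℕ.+ s)) C n))) d  ≈⟨ Δ^-sum (suc n) M _ d ⟩
      sumK M (λ s → Δ^ (suc n) (λ e → fromℕ ((e ℕ.+ (a ℕ.+ s)) C n)) d)  ≈⟨ sum-zero M (λ s _ → Δ^-binomial n (a ℕ.+ s) d) ⟩
      0#                                                                ∎
      where
        hockey : ∀ e → Δ (λ y → fromℕ ((y ℕ.+ a) C suc n)) e ≈ sumK M (λ s → fromℕ ((e ℕ.+ (a ℕ.+ s)) C n))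
        hockey e = begin
          fromℕ ((e ℕ.+ M ℕ.+ a) C suc n) - fromℕ (x C suc n)
            ≡⟨ cong (λ z → fromℕ (z C suc n) - fromℕ (x C suc n)) (+-swapʳ e M a) ⟩
          fromℕ ((x ℕ.+ M) C suc n) - fromℕ (x C suc n)
            ≡⟨ cong (λ z → fromℕ z - fromℕ (x C suc n)) (hockeyStick x M n) ⟩
          fromℕ (x C suc n ℕ.+ window) - fromℕ (x C suc n)
            ≈⟨ +-congʳ (fromℕ-+ (x C suc n) window) ⟩
          (fromℕ (x C suc n) + fromℕ window) - fromℕ (x C suc n)
            ≈⟨ [a+b]-a≈b _ _ ⟩
          fromℕ window
            ≈⟨ fromℕ-sum M _ ⟩
          sumK M (λ s → fromℕ ((x ℕ.+ s) C n))
            ≈⟨ sum-cong M (λ s _ → reflexive (cong (λ z → fromℕ (z C n)) (ℕP.+-assoc e a s))) ⟩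
          sumK M (λ s → fromℕ ((e ℕ.+ (a ℕ.+ s)) C n)) ∎
          where
            x window : ℕ
            x      = e ℕ.+ a
            window = sumN M (λ s → (x ℕ.+ s) C n)

    -- t^M · f, on coefficient sequences
    shifted : (ℕ → Carrier) → ℕ → Carrier
    shifted f i = if M ≤ᵇ i then f (i ∸ M) else 0#

    shifted-low : ∀ f i → i < M → shifted f i ≈ 0#
    shifted-low f i i<M = reflexive (cong (if_then f (i ∸ M) else 0#) (≤ᵇ-false i<M))

    shifted-high : ∀ f i → shifted f (M ℕ.+ i) ≈ f i
    shifted-high f i = reflexive (≡.trans (cong (if_then f (M ℕ.+ i ∸ M) else 0#) (≤ᵇ-true (ℕP.m≤m+n M i)))
                                          (cong f (ℕP.m+n∸m≡n M i)))

    -- coeff j i = the coefficient of tⁱ in (1 - t^M)ʲ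
    coeff : ℕ → ℕ → Carrier
    coeff zero    zero    = 1#
    coeff zero    (suc i) = 0#
    coeff (suc j) i       = coeff j i - shifted (coeff j) i

    coeff-degree : ∀ j i → j ℕ.* M < i → coeff j i ≈ 0#
    coeff-degree zero    (suc i) _       = refl
    coeff-degree (suc j) i       jM+M<i =
      trans (+-cong (coeff-degree j i (ℕP.≤-<-trans (ℕP.m≤n+m (j ℕ.* M) M) jM+M<i)) (-‿cong high)) 0-0≈0
      where
        M≤i : M ≤ i
        M≤i = ℕP.≤-trans (ℕP.m≤m+n M (j ℕ.* M)) (ℕP.<⇒≤ jM+M<i)
        jM<i-M : j ℕ.* M < i ∸ M
        jM<i-M = ℕP.m+n≤o⇒m≤o∸n (suc (j ℕ.* M))
                   (ℕP.≤-trans (ℕP.≤-reflexive (cong suc (ℕP.+-comm (j ℕ.* M) M))) jM+M<i)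
        high : shifted (coeff j) i ≈ 0#
        high = trans (reflexive (cong (if_then coeff j (i ∸ M) else 0#) (≤ᵇ-true M≤i)))
                     (coeff-degree j (i ∸ M) jM<i-M)

    coeff-const : 1 ≤ M → ∀ j → coeff j 0 ≈ 1#
    coeff-const 1≤M zero    = refl
    coeff-const 1≤M (suc j) =
      trans (+-cong (coeff-const 1≤M j) (-‿cong (shifted-low (coeff j) 0 1≤M))) (x-0≈x 1#)

    coeff-integer : ∀ j i → IsInteger (coeff j i)
    coeff-integer zero    zero    = integer-1
    coeff-integer zero    (suc i) = integer-0
    coeff-integer (suc j) i       = integer-- (coeff-integer j i) shifted-integer
      where
        shifted-integer : IsInteger (shifted (coeff j) i)
        shifted-integer with M ≤ᵇ i
        ... | true  = coeff-integer j (i ∸ M)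
        ... | false = integer-0

    -- Multiplying a series by (1 - t^M)ʲ takes j-th differences of its coefficients.
    coeff-convolution : ∀ j u d → sumK (suc (j ℕ.* M)) (λ i → coeff j i * u (d ℕ.+ j ℕ.* M ∸ i)) ≈ Δ^ j u d
    coeff-convolution zero    u d = trans (+-identityˡ _) (trans (*-identityˡ _) (reflexive (cong u (ℕP.+-identityʳ d))))
    coeff-convolution (suc j) u d = begin
      sumK (suc L) (λ i → (coeff j i - shifted (coeff j) i) * U i)
        ≈⟨ sum-cong (suc L) (λ i _ → [y-z]x≈yx-zx (U i) _ _) ⟩
      sumK (suc L) (λ i → coeff j i * U i - shifted (coeff j) i * U i)
        ≈⟨ sum-- (suc L) _ _ ⟩
      sumK (suc L) (λ i → coeff j i * U i) - sumK (suc L) (λ i → shifted (coeff j) i * U i)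
        ≈⟨ +-cong unshiftedPart (-‿cong shiftedPart) ⟩
      Δ^ j u (d ℕ.+ M) - Δ^ j u d
        ≈⟨ sym (Δ^-suc j u d) ⟩
      Δ^ (suc j) u d ∎
      where
        K′ L : ℕ
        K′ = j ℕ.* M
        L  = M ℕ.+ K′
        U : ℕ → Carrier
        U i = u (d ℕ.+ L ∸ i)

        -- the terms beyond degree j·M vanish; the rest is the j-th difference at d + M
        unshiftedPart : sumK (suc L) (λ i → coeff j i * U i) ≈ Δ^ j u (d ℕ.+ M)
        unshiftedPart = begin
          sumK (suc L) F                                       ≡⟨ cong (λ z → sumK (suc z) F) (ℕP.+-comm M K′) ⟩
          sumK (suc K′ ℕ.+ M) F                                ≈⟨ sum-split (suc K′) M F ⟩
          sumK (suc K′) F + sumK M (λ i → F (suc K′ ℕ.+ i))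
            ≈⟨ +-cong (sum-cong (suc K′) (λ i _ → *-congˡ (reflexive (cong (λ z → u (z ∸ i)) (≡.sym (ℕP.+-assoc d M K′))))))
                      (sum-zero M (λ i _ → trans (*-congʳ (coeff-degree j _ (ℕP.m≤m+n (suc K′) i))) (zeroˡ _))) ⟩
          sumK (suc K′) (λ i → coeff j i * u (d ℕ.+ M ℕ.+ K′ ∸ i)) + 0#  ≈⟨ +-identityʳ _ ⟩
          sumK (suc K′) (λ i → coeff j i * u (d ℕ.+ M ℕ.+ K′ ∸ i))       ≈⟨ coeff-convolution j u (d ℕ.+ M) ⟩
          Δ^ j u (d ℕ.+ M)                                                ∎
          where F : ℕ → Carrier
                F i = coeff j i * U i

        -- the terms below degree M vanish; the rest is the j-th difference at d
        shiftedPart : sumK (suc L) (λ i → shifted (coeff j) i * U i) ≈ Δ^ j u d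
        shiftedPart = begin
          sumK (suc L) G                                       ≡⟨ cong (λ z → sumK z G) (≡.sym (ℕP.+-suc M K′)) ⟩
          sumK (M ℕ.+ suc K′) G                                ≈⟨ sum-split M (suc K′) G ⟩
          sumK M G + sumK (suc K′) (λ i → G (M ℕ.+ i))
            ≈⟨ +-cong (sum-zero M (λ i i<M → trans (*-congʳ (shifted-low (coeff j) i i<M)) (zeroˡ _)))
                      (sum-cong (suc K′) (λ i _ → *-cong (shifted-high (coeff j) i) (reflexive (cong u (index i))))) ⟩
          0# + sumK (suc K′) (λ i → coeff j i * u (d ℕ.+ K′ ∸ i))  ≈⟨ +-identityˡ _ ⟩
          sumK (suc K′) (λ i → coeff j i * u (d ℕ.+ K′ ∸ i))       ≈⟨ coeff-convolution j u d ⟩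
          Δ^ j u d                                                  ∎
          where
            G : ℕ → Carrier
            G i = shifted (coeff j) i * U i
            index : ∀ i → d ℕ.+ L ∸ (M ℕ.+ i) ≡ d ℕ.+ K′ ∸ i
            index i = ≡.trans (cong (_∸ (M ℕ.+ i)) (≡.trans (≡.sym (ℕP.+-assoc d M K′))
                                (≡.trans (cong (ℕ._+ K′) (ℕP.+-comm d M)) (ℕP.+-assoc M d K′))))
                              (ℕP.[m+n]∸[m+o]≡n∸o M (d ℕ.+ K′) i)

  lo-as-binomial : ∀ d n′ → lo d (suc n′) ≡ (d ℕ.+ n′) C suc n′
  lo-as-binomial d n′ = cong (λ z → (z ∸ 1) C suc n′) (ℕP.+-suc d n′)

  lo≤hi : ∀ d n′ → lo d (suc n′) ≤ hi d (suc n′)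
  lo≤hi d n′ = ≡.subst₂ _≤_ (≡.sym (lo-as-binomial d n′))
    (≡.trans (nCk+nC[k+1]≡[n+1]C[k+1] (d ℕ.+ n′) n′) (cong (_C suc n′) (≡.sym (ℕP.+-suc d n′))))
    (ℕP.m≤n+m _ _)

  module Root (ζ : Carrier) (m : ℕ) (ζᵐ≈1 : ζ ^ m ≈ 1#) where

    S : ℕ → Carrier
    S x = sumK x (ζ ^_)

    pow-+ : ∀ a b → ζ ^ (a ℕ.+ b) ≈ ζ ^ a * ζ ^ b
    pow-+ zero    b = sym (*-identityˡ _)
    pow-+ (suc a) b = trans (*-congˡ (pow-+ a b)) (sym (*-assoc _ _ _))

    S-period : ∀ x → S (x ℕ.+ m) ≈ S x + S m
    S-period zero    = sym (+-identityˡ _)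
    S-period (suc x) = begin
      S (x ℕ.+ m) + ζ ^ (x ℕ.+ m)  ≈⟨ +-cong (S-period x) (trans (pow-+ x m) (trans (*-congˡ ζᵐ≈1) (*-identityʳ _))) ⟩
      (S x + S m) + ζ ^ x         ≈⟨ xy∙z≈xz∙y _ _ _ ⟩
      (S x + ζ ^ x) + S m         ∎

    -- T x = m·S x - S m·x measures the deviation of S from linearity; it is m-periodic.
    T : ℕ → Carrier
    T x = fromℕ m * S x - S m * fromℕ x

    S-decomposition : ∀ x → fromℕ m * S x ≈ S m * fromℕ x + T x
    S-decomposition x = sym (begin
      b + (a - b)    ≈⟨ +-comm b (a - b) ⟩
      (a - b) + b    ≈⟨ +-assoc a (- b) b ⟩
      a + (- b + b)  ≈⟨ +-congˡ (-‿inverseˡ b) ⟩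
      a + 0#         ≈⟨ +-identityʳ a ⟩
      a              ∎)
      where a b : Carrier
            a = fromℕ m * S x
            b = S m * fromℕ x

    T-period : ∀ x → T (x ℕ.+ m) ≈ T x
    T-period x = begin
      fromℕ m * S (x ℕ.+ m) - S m * fromℕ (x ℕ.+ m)
        ≈⟨ +-cong (*-congˡ (S-period x)) (-‿cong (*-congˡ (fromℕ-+ x m))) ⟩
      fromℕ m * (S x + S m) - S m * (fromℕ x + fromℕ m)
        ≈⟨ +-cong (distribˡ _ _ _) (-‿cong (distribˡ _ _ _)) ⟩
      (fromℕ m * S x + fromℕ m * S m) - (S m * fromℕ x + S m * fromℕ m)
        ≈⟨ sub-+ _ _ _ _ ⟩
      T x + (fromℕ m * S m - S m * fromℕ m)
        ≈⟨ +-congˡ (trans (+-congʳ (*-comm _ _)) (-‿inverseʳ _)) ⟩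
      T x + 0#
        ≈⟨ +-identityʳ _ ⟩
      T x ∎

    T-period-multiple : ∀ x t → T (x ℕ.+ t ℕ.* m) ≈ T x
    T-period-multiple x zero    = reflexive (cong T (ℕP.+-identityʳ x))
    T-period-multiple x (suc t) = trans (reflexive (cong T (≡.sym (ℕP.+-assoc x m (t ℕ.* m)))))
                                        (trans (T-period-multiple (x ℕ.+ m) t) (T-period x))

    -- Δ^{n+1} with step mⁿ kills e ↦ S (C(e + a, n)) when m is invertible: after
    -- multiplying by m it splits into S m · C(e + a, n) and the mⁿ-periodic T (C(e + a, n)).
    Δ^-S-binomial : (∀ x → ¬ x ≈ 0# → ∃[ y ] (x * y ≈ 1#)) → ¬ fromℕ m ≈ 0# →
                    ∀ n a d → Difference.Δ^ (m ℕ.^ n) (suc n) (λ e → S ((e ℕ.+ a) C n)) d ≈ 0#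
    Δ^-S-binomial inverse m≉0 n a d = cancel-nonzero inverse m≉0 (begin
      fromℕ m * Δ^ (suc n) (λ e → S (f e)) d
        ≈⟨ sym (Δ^-*ˡ (suc n) (fromℕ m) _ d) ⟩
      Δ^ (suc n) (λ e → fromℕ m * S (f e)) d
        ≈⟨ Δ^-cong (suc n) (λ e → S-decomposition (f e)) d ⟩
      Δ^ (suc n) (λ e → S m * fromℕ (f e) + T (f e)) d
        ≈⟨ Δ^-+ (suc n) _ _ d ⟩
      Δ^ (suc n) (λ e → S m * fromℕ (f e)) d + Δ^ (suc n) (λ e → T (f e)) d
        ≈⟨ +-cong (Δ^-*ˡ (suc n) (S m) _ d) (Δ^-periodic n _ T∘f-periodic d) ⟩
      S m * Δ^ (suc n) (λ e → fromℕ (f e)) d + 0#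
        ≈⟨ +-identityʳ _ ⟩
      S m * Δ^ (suc n) (λ e → fromℕ (f e)) d
        ≈⟨ *-congˡ (Δ^-binomial n a d) ⟩
      S m * 0#
        ≈⟨ zeroʳ _ ⟩
      0# ∎)
      where
        open Difference (m ℕ.^ n)
        f : ℕ → ℕ
        f e = (e ℕ.+ a) C n
        T∘f-periodic : ∀ e → T (f (e ℕ.+ m ℕ.^ n)) ≈ T (f e)
        T∘f-periodic e with binomial-periodic m n (e ℕ.+ a)
        ... | t , step = trans (reflexive (cong T (≡.trans (cong (_C n) (+-swapʳ e (m ℕ.^ n) a)) step)))
                               (T-period-multiple (f e) t)

    Pat-difference : ∀ d n → lo d n ≤ hi d n → Pat ζ d n ≈ S (hi d n) - S (lo d n)
    Pat-difference d n ordered = move-right _ _ _ (sum-from (hi d n) (lo d n) (ζ ^_) ordered)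

    rational : IsField → CharZero → 1 ≤ m → ∀ n′ → RationalOverQζ ζ (suc n′)
    rational (1≉0 , inverse) char0 1≤m n′ =
      k , coeff (suc n) , (λ i _ → integer⇒InQζ 1≉0 ζ (coeff-integer (suc n) i)) ,
      (0 , z≤n , λ b₀≈0 → 1≉0 (trans (sym (coeff-const 1≤M (suc n))) b₀≈0)) ,
      0 , λ d _ → kills d
      where
        n M k : ℕ
        n = suc n′
        M = m ℕ.^ n
        k = suc n ℕ.* M
        open Difference M

        1≤M : 1 ≤ M
        1≤M = ℕP.m^n>0 m ⦃ ℕ.>-nonZero 1≤m ⦄ n

        m≉0 : ¬ fromℕ m ≈ 0#
        m≉0 m≈0 with ≡.subst (1 ≤_) (char0 m m≈0) 1≤m
        ... | ()

        V : ℕ → Carrier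
        V e = S (hi e n) - S (lo e n)

        kills : ∀ d → sumK (suc k) (λ i → coeff (suc n) i * Pat ζ (d ℕ.+ k ∸ i) n) ≈ 0#
        kills d = begin
          sumK (suc k) (λ i → coeff (suc n) i * Pat ζ (d ℕ.+ k ∸ i) n)
            ≈⟨ sum-cong (suc k) (λ i _ → *-congˡ (Pat-difference (d ℕ.+ k ∸ i) n (lo≤hi (d ℕ.+ k ∸ i) n′))) ⟩
          sumK (suc k) (λ i → coeff (suc n) i * V (d ℕ.+ k ∸ i))
            ≈⟨ coeff-convolution (suc n) V d ⟩
          Δ^ (suc n) V d
            ≈⟨ Δ^-- (suc n) _ _ d ⟩
          Δ^ (suc n) (λ e → S (hi e n)) d - Δ^ (suc n) (λ e → S (lo e n)) d
            ≈⟨ +-cong (Δ^-S-binomial inverse m≉0 n n d)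
                      (-‿cong (trans (Δ^-cong (suc n) (λ e → reflexive (cong S (lo-as-binomial e n′))) d)
                                     (Δ^-S-binomial inverse m≉0 n n′ d))) ⟩
          0# - 0#
            ≈⟨ 0-0≈0 ⟩
          0# ∎

rational-at-roots-of-unity : ∀ {c ℓ} n′ (K : CommutativeRing c ℓ) → OverRing.IsField K → OverRing.CharZero K →
  (ζ : CommutativeRing.Carrier K) → OverRing.IsRootOfUnity K ζ → OverRing.RationalOverQζ K ζ (suc n′)
rational-at-roots-of-unity n′ K isField char0 ζ (m , 1≤m , ζᵐ≈1) =
  AtRootOfUnity.Root.rational K ζ m ζᵐ≈1 isField char0 1≤m n′

theorem5p10 : ∀ {c ℓ} (n : ℕ) → 1 ≤ n →
    (RationalOverQx n ⇔ n ≡ 1)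
    × (∀ (K : CommutativeRing c ℓ) → OverRing.IsField K → OverRing.CharZero K →
         (ζ : CommutativeRing.Carrier K) → OverRing.IsRootOfUnity K ζ →
         OverRing.RationalOverQζ K ζ n)
theorem5p10 (suc zero)    _ =
  mk⇔ (λ _ → ≡.refl) (λ _ → OverQx.rational-deg1) , rational-at-roots-of-unity 0
theorem5p10 (suc (suc r)) _ =
  mk⇔ (λ rational → ⊥-elim (OverQx.not-rational r rational)) (λ ()) , rational-at-roots-of-unity (suc r)
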